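{- Let $A,a$ be positive integers. As formal power series in $q$, $$\sum_{n\geq0}\overline{p}_{A,a}(n)q^n=\frac{1}{(q;q)_\infty}\sum_{n\geq0}(-1)^nq^{\frac{An(n+1)}{2}+a(n+1)}.$$
   Context: $(q;q)_\infty=\prod_{k\ge1}(1-q^k)$. A partition of $n$ is a finite multiset of positive integers summing to $n$. For positive integers $A,a$ and a partition $\pi$, $\mathrm{mex}_{A,a}(\pi)$ is the smallest element of $\{a,a+A,a+2A,\dots\}$ that is not a part of $\pi$. $\overline{p}_{A,a}(n)$ is the number of partitions $\pi$ of $n$ with $\mathrm{mex}_{A,a}(\pi)\equiv A+a \pmod{2A}$. -}

module Defs where

open import Data.Nat using (ℕ; _≡ᵇ_; zero; suc; _+_; _*_; _∸_; _≥_; _>_; _/_; _%_; NonZero)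
open import Data.Nat.Properties using (_≟_; m*n≢0)
open import Data.Integer as ℤ using (ℤ; +_; -_)
open import Data.Bool using (Bool; true; false; if_then_else_)
open import Data.List using (List; []; _∷_; upTo; map; zipWith; applyUpTo; foldr)
open import Data.Nat.ListAction using (sum)
open import Data.List.Relation.Unary.All using (All)
open import Data.List.Relation.Unary.Linked using (Linked)
open import Data.List.Membership.DecPropositional _≟_ using (_∈?_)
open import Data.Product using (Σ; _×_)
open import Relation.Nullary using (does)
open import Relation.Binary.PropositionalEquality using (_≡_)

-- Partitions of n: multisets of positive integers summing to n,
-- represented canonically as weakly decreasing lists.

IsPartitionOf : ℕ → List ℕ → Set
IsPartitionOf n π = Linked _≥_ π × All (_> 0) π × sum π ≡ n

Partition : ℕ → Set
Partition n = Σ (List ℕ) (IsPartitionOf n)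

_∈ᵇ_ : ℕ → List ℕ → Bool
x ∈ᵇ π = does (x ∈? π)

-- "mex_{A,a}(π) = a + j*A": a + j*A is not a part, while
-- a, a + A, ..., a + (j-1)*A all are parts.
MexIndex : (A a : ℕ) → List ℕ → ℕ → Set
MexIndex A a π j =
  ((a + j * A) ∈ᵇ π ≡ false) × All (λ i → (a + i * A) ∈ᵇ π ≡ true) (upTo j)

MexCond : (A a : ℕ) → .{{NonZero A}} → List ℕ → Set
MexCond A a π =
  Σ ℕ λ j → MexIndex A a π j ×
    ((a + j * A) % (2 * A)) {{m*n≢0 2 A}} ≡ ((A + a) % (2 * A)) {{m*n≢0 2 A}}

MexPartition : (A a : ℕ) → .{{NonZero A}} → ℕ → Set
MexPartition A a n = Σ (List ℕ) λ π → IsPartitionOf n π × MexCond A a π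

Series : Set
Series = ℕ → ℤ

sumℤ : List ℤ → ℤ
sumℤ = foldr ℤ._+_ (+ 0)

_⊛_ : Series → Series → Series
(f ⊛ g) n = sumℤ (applyUpTo (λ i → f i ℤ.* g (n ∸ i)) (suc n))

δ : ℕ → ℕ → ℤ
δ m n = if n ≡ᵇ m then + 1 else + 0

oneS : Series
oneS = δ 0

1-q^ : ℕ → Series
1-q^ k n = δ 0 n ℤ.- δ k n

qPoch : ℕ → Series
qPoch zero    = oneS
qPoch (suc N) = qPoch N ⊛ 1-q^ (suc N)

-- (q;q)_∞ : its q^n coefficient equals that of (q;q)_N for any N ≥ n
qPoch∞ : Series
qPoch∞ n = qPoch n n

-- Multiplicative inverse of a series f with constant term 1:
-- b_0 = 1, b_{n+1} = - Σ_{k=1}^{n+1} f_k b_{n+1-k}.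
-- invList f n = b_n ∷ b_{n-1} ∷ ... ∷ b_0 ∷ []
invList : Series → ℕ → List ℤ
invList f zero    = + 1 ∷ []
invList f (suc n) =
  (ℤ.- sumℤ (zipWith ℤ._*_ (applyUpTo (λ k → f (suc k)) (suc n)) (invList f n)))
  ∷ invList f n

headℤ : List ℤ → ℤ
headℤ []      = + 0
headℤ (x ∷ _) = x

inv : Series → Series
inv f n = headℤ (invList f n)

sgn : ℕ → ℤ
sgn zero    = + 1
sgn (suc n) = ℤ.- sgn n

expo : ℕ → ℕ → ℕ → ℕ
expo A a n = (A * n * suc n) / 2 + a * suc n

-- Σ_{n ≥ 0} (-1)^n q^{A n(n+1)/2 + a(n+1)}; for a ≥ 1 the exponent
-- exceeds n, so only n ≤ m contribute to the q^m coefficient.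
thetaS : ℕ → ℕ → Series
thetaS A a m = sumℤ (applyUpTo (λ n → sgn n ℤ.* δ m (expo A a n)) (suc m))

rhsSeries : ℕ → ℕ → Series
rhsSeries A a = inv qPoch∞ ⊛ thetaS A a

-- Write the mex of a partition as a + jA; it is ≡ A + a (mod 2A) exactly when j is odd. A partition
-- contains a, a + A, …, a + (k − 1)A iff j ≥ k, and removing one copy of each of these parts shows
-- that p(n − s_k) partitions of n do, where s_k = ka + A k(k − 1)/2. Splitting them by the parity
-- of j − k gives p(n − s_{k+1}) = o_k + o_{k+1}, where o_k counts the partitions with j ≥ k and
-- j − k odd. Since o_{n+1} = 0, telescoping yields o_0 = Σ_j (−1)^j p(n − s_{j+1}), which is the
-- q^n coefficient of the right-hand side by Euler's 1/(q;q)_∞ = Σ p(n) q^n; the latter follows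
-- from p_N(n) = p_{N−1}(n) + p_N(n − N) for the number p_N(n) of partitions with parts at most N.

module Submission where

open import Defs

open import Axiom.UniquenessOfIdentityProofs using (module Decidable⇒UIP)
import Algebra.Properties.CommutativeSemigroup as CommutativeSemigroupProperties
open import Data.Bool using (Bool; T; true; false; if_then_else_; _∨_)
open import Data.Bool.Properties using (∨-zeroʳ) renaming (_≟_ to _≟𝔹_)
open import Data.Empty using (⊥; ⊥-elim)
open import Data.Fin as Fin using (Fin)
open import Data.Fin.Permutation using (↔⇒≡)
open import Data.Fin.Properties using (+↔⊎)
open import Data.Integer as ℤ using (ℤ; +_) renaming (_+_ to _+ℤ_; _*_ to _*ℤ_; -_ to -ℤ_)
import Data.Integer.Properties as ℤ
open import Algebra.Properties.AbelianGroup ℤ.+-0-abelianGroup using (//-rightDividesʳ; inverseˡ-unique)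
open import Data.List using (List; []; _∷_; _++_; head; upTo; applyUpTo; zipWith)
open import Data.List.Properties using (applyUpTo-∷ʳ; upTo-∷ʳ)
open import Data.List.Relation.Unary.All as All using (All; []; _∷_)
open import Data.List.Relation.Unary.All.Properties using (applyUpTo⁺₁; applyUpTo⁻; ∷ʳ⁺)
open import Data.List.Relation.Unary.AllPairs using ([]; _∷_)
open import Data.List.Relation.Unary.AllPairs.Properties using ()
  renaming (applyUpTo⁺₁ to allPairs-applyUpTo⁺₁)
open import Data.List.Relation.Unary.Any using (here)
open import Data.List.Relation.Unary.Linked as Linked using (Linked; []; [-]; _∷_; _∷′_; head′)
open import Data.List.Relation.Unary.Unique.Propositional using (Unique)
open import Data.Maybe using (just)
import Data.Maybe.Properties as Maybe
open import Data.Maybe.Relation.Binary.Connected using (Connected; just; just-nothing)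
open import Data.Nat using (ℕ; NonZero; zero; suc; _+_; _*_; _∸_; _/_; _%_; _≤_; _<_; _≥_; _>_;
                            z≤n; s≤s; z<s; s<s; _≤?_; _≡ᵇ_; >-nonZero⁻¹; parity)
open import Data.Nat.DivMod using (m*n/n≡m; m≡m%n+[m/n]*n; [m+n]%n≡m%n)
open import Data.Nat.Divisibility using (_∣_; ∣m+n∣m⇒∣n; ∣⇒≤; n∣m*n)
open import Data.Nat.ListAction using (sum)
open import Data.Nat.ListAction.Properties using (sum-++)
open import Data.Nat.Properties
open import Data.List.Membership.DecPropositional _≟_ using (_∈?_)
open import Data.Nat.Tactic.RingSolver using (solve-∀)
open import Data.Parity.Base using (Parity; 0ℙ; 1ℙ; _⁻¹)
open import Data.Parity.Properties using (suc-homo-⁻¹; ⁻¹-selfInverse) renaming (_≟_ to _≟ℙ_)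
open import Data.Product using (Σ; _×_; _,_; proj₁; proj₂)
open import Data.Product.Function.Dependent.Propositional using (Σ-↔)
open import Data.Sum using (_⊎_; inj₁; inj₂; [_,_])
open import Data.Sum.Function.Propositional using (_⊎-↔_)
open import Data.Unit using (tt)
open import Function.Bundles using (_↔_; Inverse; mk↔ₛ′)
open import Function.Properties.Inverse using (↔-refl; ↔-sym; ↔-trans)
open import Function.Related.TypeIsomorphisms using (Σ-assoc; Σ-distribˡ-⊎)
open import Relation.Binary.Definitions using (tri<; tri≈; tri>)
open import Relation.Binary.PropositionalEquality
  using (_≡_; _≢_; _≗_; refl; sym; trans; cong; cong₂; subst; module ≡-Reasoning)
open import Relation.Nullary using (Dec; yes; no; ¬_; contradiction)
open import Relation.Nullary.Decidable using (dec-true)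
import Relation.Nullary.Irrelevant as Nullary
open import Relation.Unary using (Decidable; Irrelevant; _⊆_; _∪_; _∩_)

private
  module ℕ+ = CommutativeSemigroupProperties +-commutativeSemigroup
  module ℤ+ = CommutativeSemigroupProperties ℤ.+-commutativeSemigroup
  module ℤ* = CommutativeSemigroupProperties ℤ.*-commutativeSemigroup

∑ : ℕ → (ℕ → ℤ) → ℤ
∑ m h = sumℤ (applyUpTo h m)

syntax ∑ m (λ i → e) = ∑[ i < m ] e

∑-cong : ∀ {h h′ : ℕ → ℤ} m → (∀ i → i < m → h i ≡ h′ i) → ∑ m h ≡ ∑ m h′
∑-cong zero    eq = refl
∑-cong (suc m) eq = cong₂ _+ℤ_ (eq 0 z<s) (∑-cong m (λ i i<m → eq (suc i) (s<s i<m)))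

∑-zero : ∀ {h : ℕ → ℤ} m → (∀ i → i < m → h i ≡ + 0) → ∑ m h ≡ + 0
∑-zero zero    eq = refl
∑-zero (suc m) eq = cong₂ _+ℤ_ (eq 0 z<s) (∑-zero m (λ i i<m → eq (suc i) (s<s i<m)))

∑-distrib-+ : ∀ (h g : ℕ → ℤ) m → ∑[ i < m ] (h i +ℤ g i) ≡ ∑ m h +ℤ ∑ m g
∑-distrib-+ h g zero    = refl
∑-distrib-+ h g (suc m) = begin
  (h 0 +ℤ g 0) +ℤ ∑[ i < m ] (h (suc i) +ℤ g (suc i))
    ≡⟨ cong ((h 0 +ℤ g 0) +ℤ_) (∑-distrib-+ (λ i → h (suc i)) (λ i → g (suc i)) m) ⟩
  (h 0 +ℤ g 0) +ℤ (∑[ i < m ] h (suc i) +ℤ ∑[ i < m ] g (suc i))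
    ≡⟨ ℤ+.interchange (h 0) (g 0) _ _ ⟩
  (h 0 +ℤ ∑[ i < m ] h (suc i)) +ℤ (g 0 +ℤ ∑[ i < m ] g (suc i))
    ∎
  where open ≡-Reasoning

∑-*ˡ : ∀ c (h : ℕ → ℤ) m → ∑[ i < m ] (c *ℤ h i) ≡ c *ℤ ∑ m h
∑-*ˡ c h zero    = sym (ℤ.*-zeroʳ c)
∑-*ˡ c h (suc m) = trans (cong (c *ℤ h 0 +ℤ_) (∑-*ˡ c (λ i → h (suc i)) m))
                         (sym (ℤ.*-distribˡ-+ c (h 0) _))

∑-neg : ∀ (h : ℕ → ℤ) m → ∑[ i < m ] (-ℤ h i) ≡ -ℤ ∑ m h
∑-neg h zero    = refl
∑-neg h (suc m) = trans (cong (-ℤ h 0 +ℤ_) (∑-neg (λ i → h (suc i)) m))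
                        (sym (ℤ.neg-distrib-+ (h 0) _))

∑-split : ∀ (h : ℕ → ℤ) k m → ∑ (k + m) h ≡ ∑ k h +ℤ ∑[ i < m ] h (k + i)
∑-split h zero    m = sym (ℤ.+-identityˡ _)
∑-split h (suc k) m = trans (cong (h 0 +ℤ_) (∑-split (λ i → h (suc i)) k m))
                            (sym (ℤ.+-assoc (h 0) _ _))

∑-last : ∀ (h : ℕ → ℤ) m → ∑ (suc m) h ≡ ∑ m h +ℤ h m
∑-last h zero    = trans (ℤ.+-identityʳ (h 0)) (sym (ℤ.+-identityˡ (h 0)))
∑-last h (suc m) = trans (cong (h 0 +ℤ_) (∑-last (λ i → h (suc i)) m))
                         (sym (ℤ.+-assoc (h 0) _ _))

∑-reverse : ∀ (h : ℕ → ℤ) n → ∑ (suc n) h ≡ ∑[ i < suc n ] h (n ∸ i)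
∑-reverse h zero    = refl
∑-reverse h (suc n) = begin
  h 0 +ℤ ∑[ i < suc n ] h (suc i)                    ≡⟨ cong (h 0 +ℤ_) (∑-reverse (λ i → h (suc i)) n) ⟩
  h 0 +ℤ ∑[ i < suc n ] h (suc (n ∸ i))              ≡⟨ ℤ.+-comm (h 0) _ ⟩
  ∑[ i < suc n ] h (suc (n ∸ i)) +ℤ h 0              ≡⟨ cong₂ _+ℤ_ (∑-cong (suc n) inner) (cong h (sym (n∸n≡0 n))) ⟩
  ∑[ i < suc n ] h (suc n ∸ i) +ℤ h (suc n ∸ suc n)  ≡⟨ sym (∑-last (λ i → h (suc n ∸ i)) (suc n)) ⟩
  ∑[ i < suc (suc n) ] h (suc n ∸ i)                 ∎
  where
  open ≡-Reasoning
  inner : ∀ i → i < suc n → h (suc (n ∸ i)) ≡ h (suc n ∸ i)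
  inner i i<1+n = cong h (sym (+-∸-assoc 1 (≤-pred i<1+n)))

alternating-sum : ∀ (o h : ℕ → ℤ) → (∀ k → h k ≡ o k +ℤ o (suc k)) →
                  ∀ m k → o (k + m) ≡ + 0 → o k ≡ ∑[ j < m ] (sgn j *ℤ h (k + j))
alternating-sum o h h≡ zero    k o[k+0]≡0 = trans (cong o (sym (+-identityʳ k))) o[k+0]≡0
alternating-sum o h h≡ (suc m) k o[k+1+m]≡0 = begin
  o k                                                ≡⟨ sym (//-rightDividesʳ (o (suc k)) (o k)) ⟩
  (o k +ℤ o (suc k)) +ℤ -ℤ o (suc k)                 ≡⟨ cong₂ (λ x y → x +ℤ -ℤ y) (sym (h≡ k)) IH ⟩
  h k +ℤ -ℤ ∑[ j < m ] (sgn j *ℤ h (suc k + j))      ≡⟨ cong₂ _+ℤ_ head-term (sym (∑-neg _ m)) ⟩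
  sgn 0 *ℤ h (k + 0) +ℤ ∑[ j < m ] (-ℤ (sgn j *ℤ h (suc k + j)))
                                                     ≡⟨ cong (sgn 0 *ℤ h (k + 0) +ℤ_) (∑-cong m tail-term) ⟩
  ∑[ j < suc m ] (sgn j *ℤ h (k + j))                ∎
  where
  open ≡-Reasoning
  IH : o (suc k) ≡ ∑[ j < m ] (sgn j *ℤ h (suc k + j))
  IH = alternating-sum o h h≡ m (suc k) (trans (cong o (sym (+-suc k m))) o[k+1+m]≡0)
  head-term : h k ≡ sgn 0 *ℤ h (k + 0)
  head-term = trans (sym (ℤ.*-identityˡ (h k))) (cong (λ i → + 1 *ℤ h i) (sym (+-identityʳ k)))
  tail-term : ∀ j → j < m → -ℤ (sgn j *ℤ h (suc k + j)) ≡ sgn (suc j) *ℤ h (k + suc j)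
  tail-term j _ = trans (ℤ.neg-distribˡ-* (sgn j) _) (cong (λ i → sgn (suc j) *ℤ h i) (sym (+-suc k j)))

-- Formal power series

shiftWith : ∀ {X : Set} → X → ℕ → (ℕ → X) → ℕ → X
shiftWith z k f n with k ≤? n
... | yes _ = f (n ∸ k)
... | no  _ = z

shift : ℕ → Series → Series
shift = shiftWith (+ 0)

shiftWith-≤ : ∀ {X : Set} {z : X} k f {n} → k ≤ n → shiftWith z k f n ≡ f (n ∸ k)
shiftWith-≤ k f {n} k≤n with k ≤? n
... | yes _   = refl
... | no  k≰n = contradiction k≤n k≰n

shiftWith-≰ : ∀ {X : Set} {z : X} k f {n} → ¬ k ≤ n → shiftWith z k f n ≡ z
shiftWith-≰ k f {n} k≰n with k ≤? n
... | yes k≤n = contradiction k≤n k≰n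
... | no  _   = refl

shiftWith-+ : ∀ {X : Set} {z : X} c s f {n} → c ≤ n → shiftWith z (c + s) f n ≡ shiftWith z s f (n ∸ c)
shiftWith-+ c s f {n} c≤n with s ≤? n ∸ c
... | yes s≤n∸c = trans (shiftWith-≤ (c + s) f c+s≤n) (cong f (sym (∸-+-assoc n c s)))
  where
  c+s≤n : c + s ≤ n
  c+s≤n = ≤-trans (+-monoʳ-≤ c s≤n∸c) (≤-reflexive (m+[n∸m]≡n c≤n))
... | no  s≰n∸c = shiftWith-≰ (c + s) f λ c+s≤n →
  s≰n∸c (≤-trans (≤-reflexive (sym (m+n∸m≡n c s))) (∸-monoˡ-≤ c c+s≤n))

shiftWith-map : ∀ {X Y : Set} (g : X → Y) {z} k f n →
                g (shiftWith z k f n) ≡ shiftWith (g z) k (λ m → g (f m)) n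
shiftWith-map g k f n with k ≤? n
... | yes _ = refl
... | no  _ = refl

shift-≤ : ∀ k f {n} → k ≤ n → shift k f n ≡ f (n ∸ k)
shift-≤ = shiftWith-≤

shift-≰ : ∀ k f {n} → ¬ k ≤ n → shift k f n ≡ + 0
shift-≰ = shiftWith-≰

shift-suc : ∀ k f n → shift (suc k) f (suc n) ≡ shift k f n
shift-suc k f n with k ≤? n
... | yes k≤n = shift-≤ (suc k) f (s≤s k≤n)
... | no  k≰n = shift-≰ (suc k) f (λ k<n → k≰n (≤-pred k<n))

shift-cong : ∀ k {f g} → f ≗ g → shift k f ≗ shift k g
shift-cong k f≗g n with k ≤? n
... | yes _ = f≗g (n ∸ k)
... | no  _ = refl

δ-sym : ∀ m n → δ m n ≡ δ n m
δ-sym m n = cong (if_then + 1 else + 0) (≡ᵇ-sym n m)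
  where
  ≡ᵇ-sym : ∀ m n → (m ≡ᵇ n) ≡ (n ≡ᵇ m)
  ≡ᵇ-sym zero    zero    = refl
  ≡ᵇ-sym zero    (suc n) = refl
  ≡ᵇ-sym (suc m) zero    = refl
  ≡ᵇ-sym (suc m) (suc n) = ≡ᵇ-sym m n

δ-≢ : ∀ {m n} → n ≢ m → δ m n ≡ + 0
δ-≢ {m} {n} n≢m with n ≡ᵇ m in eq
... | true  = ⊥-elim (n≢m (≡ᵇ⇒≡ n m (subst T (sym eq) tt)))
... | false = refl

δ≗shift-oneS : ∀ k → δ k ≗ shift k oneS
δ≗shift-oneS zero    n       = refl
δ≗shift-oneS (suc k) zero    = refl
δ≗shift-oneS (suc k) (suc n) = trans (δ≗shift-oneS k n) (sym (shift-suc k oneS n))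

⊛-congʳ : ∀ f {g g′} n → (∀ i → i ≤ n → g i ≡ g′ i) → (f ⊛ g) n ≡ (f ⊛ g′) n
⊛-congʳ f n eq = ∑-cong (suc n) (λ i _ → cong (f i *ℤ_) (eq (n ∸ i) (m∸n≤m n i)))

⊛-comm : ∀ f g → f ⊛ g ≗ g ⊛ f
⊛-comm f g n = trans (∑-reverse (λ i → f i *ℤ g (n ∸ i)) n) (∑-cong (suc n) swap)
  where
  swap : ∀ i → i < suc n → f (n ∸ i) *ℤ g (n ∸ (n ∸ i)) ≡ g i *ℤ f (n ∸ i)
  swap i i<1+n = trans (ℤ.*-comm (f (n ∸ i)) _) (cong (λ j → g j *ℤ f (n ∸ i)) (m∸[m∸n]≡n (≤-pred i<1+n)))

⊛-congˡ : ∀ {f f′} g n → (∀ i → i ≤ n → f i ≡ f′ i) → (f ⊛ g) n ≡ (f′ ⊛ g) n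
⊛-congˡ {f} {f′} g n eq = trans (⊛-comm f g n) (trans (⊛-congʳ g n eq) (⊛-comm g f′ n))

⊛-distribˡ-+ : ∀ f g h n → (f ⊛ (λ m → g m +ℤ h m)) n ≡ (f ⊛ g) n +ℤ (f ⊛ h) n
⊛-distribˡ-+ f g h n = trans
  (∑-cong {h′ = λ i → f i *ℤ g (n ∸ i) +ℤ f i *ℤ h (n ∸ i)} (suc n) (λ i _ → ℤ.*-distribˡ-+ (f i) _ _))
  (∑-distrib-+ (λ i → f i *ℤ g (n ∸ i)) (λ i → f i *ℤ h (n ∸ i)) (suc n))

⊛-distribʳ-+ : ∀ f g h n → ((λ m → g m +ℤ h m) ⊛ f) n ≡ (g ⊛ f) n +ℤ (h ⊛ f) n
⊛-distribʳ-+ f g h n = trans (⊛-comm (λ m → g m +ℤ h m) f n)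
  (trans (⊛-distribˡ-+ f g h n) (cong₂ _+ℤ_ (⊛-comm f g n) (⊛-comm f h n)))

⊛-scaleʳ : ∀ f g c n → (f ⊛ (λ m → c *ℤ g m)) n ≡ c *ℤ (f ⊛ g) n
⊛-scaleʳ f g c n = trans
  (∑-cong {h′ = λ i → c *ℤ (f i *ℤ g (n ∸ i))} (suc n) (λ i _ → ℤ*.x∙yz≈y∙xz (f i) c _))
  (∑-*ˡ c (λ i → f i *ℤ g (n ∸ i)) (suc n))

⊛-negʳ : ∀ f g n → (f ⊛ (λ m → -ℤ g m)) n ≡ -ℤ (f ⊛ g) n
⊛-negʳ f g n = trans
  (∑-cong {h′ = λ i → -ℤ (f i *ℤ g (n ∸ i))} (suc n) (λ i _ → sym (ℤ.neg-distribʳ-* (f i) _)))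
  (∑-neg (λ i → f i *ℤ g (n ∸ i)) (suc n))

⊛-negˡ : ∀ f g n → ((λ m → -ℤ g m) ⊛ f) n ≡ -ℤ (g ⊛ f) n
⊛-negˡ f g n = trans (⊛-comm (λ m → -ℤ g m) f n) (trans (⊛-negʳ f g n) (cong -ℤ_ (⊛-comm f g n)))

⊛-identityˡ : ∀ g → oneS ⊛ g ≗ g
⊛-identityˡ g n = trans (cong₂ _+ℤ_ (ℤ.*-identityˡ (g n)) (∑-zero n (λ _ _ → refl)))
                        (ℤ.+-identityʳ (g n))

⊛-identityʳ : ∀ g → g ⊛ oneS ≗ g
⊛-identityʳ g n = trans (⊛-comm g oneS n) (⊛-identityˡ g n)

⊛-shiftˡ : ∀ k f g → shift k f ⊛ g ≗ shift k (f ⊛ g)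
⊛-shiftˡ k f g n with k ≤? n
... | no k≰n = ∑-zero (suc n) λ i i<1+n →
  cong (_*ℤ g (n ∸ i)) (shift-≰ k f (λ k≤i → k≰n (≤-trans k≤i (≤-pred i<1+n))))
... | yes k≤n = begin
  ∑ (suc n) H                                ≡⟨ cong (λ l → ∑ l H) (sym k+[m+1]≡n+1) ⟩
  ∑ (k + suc m) H                            ≡⟨ ∑-split H k (suc m) ⟩
  ∑ k H +ℤ ∑[ i < suc m ] H (k + i)          ≡⟨ cong₂ _+ℤ_ (∑-zero k below-k) (∑-cong (suc m) above-k) ⟩
  + 0 +ℤ (f ⊛ g) m                           ≡⟨ ℤ.+-identityˡ _ ⟩
  (f ⊛ g) m                                  ∎
  where
  open ≡-Reasoning
  m = n ∸ k
  H = λ i → shift k f i *ℤ g (n ∸ i)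
  k+[m+1]≡n+1 : k + suc m ≡ suc n
  k+[m+1]≡n+1 = trans (+-suc k m) (cong suc (m+[n∸m]≡n k≤n))
  below-k : ∀ i → i < k → H i ≡ + 0
  below-k i i<k = cong (_*ℤ g (n ∸ i)) (shift-≰ k f (<⇒≱ i<k))
  above-k : ∀ i → i < suc m → H (k + i) ≡ f i *ℤ g (m ∸ i)
  above-k i _ = cong₂ _*ℤ_
    (trans (shift-≤ k f (m≤m+n k i)) (cong f (m+n∸m≡n k i)))
    (cong g (trans (cong (_∸ (k + i)) (sym (m+[n∸m]≡n k≤n))) ([m+n]∸[m+o]≡n∸o k m i)))

⊛-shiftʳ : ∀ k f g → f ⊛ shift k g ≗ shift k (f ⊛ g)
⊛-shiftʳ k f g n =
  trans (⊛-comm f (shift k g) n) (trans (⊛-shiftˡ k g f n) (shift-cong k (⊛-comm g f) n))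

⊛-δ : ∀ k f → f ⊛ δ k ≗ shift k f
⊛-δ k f n = trans (⊛-congʳ f n (λ i _ → δ≗shift-oneS k i))
                  (trans (⊛-shiftʳ k f oneS n) (shift-cong k (⊛-identityʳ f) n))

⊛-1-q^ : ∀ g k n → (g ⊛ 1-q^ k) n ≡ g n +ℤ -ℤ shift k g n
⊛-1-q^ g k n = begin
  (g ⊛ 1-q^ k) n                               ≡⟨ ⊛-distribˡ-+ g oneS (λ m → -ℤ δ k m) n ⟩
  (g ⊛ oneS) n +ℤ (g ⊛ (λ m → -ℤ δ k m)) n     ≡⟨ cong₂ _+ℤ_ (⊛-identityʳ g n) (⊛-negʳ g (δ k) n) ⟩
  g n +ℤ -ℤ (g ⊛ δ k) n                        ≡⟨ cong (λ x → g n +ℤ -ℤ x) (⊛-δ k g n) ⟩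
  g n +ℤ -ℤ shift k g n                        ∎
  where open ≡-Reasoning

qPoch-stable : ∀ {N i} → i ≤ N → qPoch N i ≡ qPoch∞ i
qPoch-stable {zero}  z≤n = refl
qPoch-stable {suc N} {i} i≤1+N with i ≤? N
... | no  i≰N = cong (λ M → qPoch M i) (≤-antisym (≰⇒> i≰N) i≤1+N)
... | yes i≤N = begin
  qPoch (suc N) i                            ≡⟨ ⊛-1-q^ (qPoch N) (suc N) i ⟩
  qPoch N i +ℤ -ℤ shift (suc N) (qPoch N) i  ≡⟨ cong (λ x → qPoch N i +ℤ -ℤ x) shifted-out ⟩
  qPoch N i +ℤ + 0                           ≡⟨ ℤ.+-identityʳ _ ⟩
  qPoch N i                                  ≡⟨ qPoch-stable i≤N ⟩
  qPoch∞ i                                   ∎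
  where
  open ≡-Reasoning
  shifted-out : shift (suc N) (qPoch N) i ≡ + 0
  shifted-out = shift-≰ (suc N) (qPoch N) (<⇒≱ (s≤s i≤N))

inv-suc : ∀ f n → inv f (suc n) ≡ -ℤ ∑[ i < suc n ] (f (suc i) *ℤ inv f (n ∸ i))
inv-suc f n = cong (λ l → -ℤ sumℤ l)
  (trans (cong (zipWith _*ℤ_ (applyUpTo (λ k → f (suc k)) (suc n))) (invList-reversed n))
         (zipWith-applyUpTo (λ k → f (suc k)) (λ i → inv f (n ∸ i)) (suc n)))
  where
  invList-reversed : ∀ n → invList f n ≡ applyUpTo (λ i → inv f (n ∸ i)) (suc n)
  invList-reversed zero    = refl
  invList-reversed (suc n) = cong (inv f (suc n) ∷_) (invList-reversed n)
  zipWith-applyUpTo : ∀ (g h : ℕ → ℤ) m →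
                      zipWith _*ℤ_ (applyUpTo g m) (applyUpTo h m) ≡ applyUpTo (λ i → g i *ℤ h i) m
  zipWith-applyUpTo g h zero    = refl
  zipWith-applyUpTo g h (suc m) =
    cong (g 0 *ℤ h 0 ∷_) (zipWith-applyUpTo (λ i → g (suc i)) (λ i → h (suc i)) m)

inv-unique : ∀ f g → f 0 ≡ + 1 → f ⊛ g ≗ oneS → inv f ≗ g
inv-unique f g f₀≡1 fg≗1 n = agrees-below n n ≤-refl
  where
  open ≡-Reasoning
  -- The q^(n+1) coefficient of f ⊛ g = 1 is the recurrence defining inv f.
  recurrence : ∀ n → g (suc n) ≡ -ℤ ∑[ i < suc n ] (f (suc i) *ℤ g (n ∸ i))
  recurrence n = inverseˡ-unique (g (suc n)) S coefficient
    where
    S = ∑[ i < suc n ] (f (suc i) *ℤ g (n ∸ i))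
    coefficient : g (suc n) +ℤ S ≡ + 0
    coefficient = trans
      (cong (_+ℤ S) (trans (sym (ℤ.*-identityˡ (g (suc n)))) (cong (_*ℤ g (suc n)) (sym f₀≡1))))
      (fg≗1 (suc n))
  agrees-below : ∀ n m → m ≤ n → inv f m ≡ g m
  agrees-below zero zero z≤n = begin
    + 1                          ≡⟨ sym (fg≗1 0) ⟩
    f 0 *ℤ g 0 +ℤ + 0            ≡⟨ cong (λ x → x *ℤ g 0 +ℤ + 0) f₀≡1 ⟩
    + 1 *ℤ g 0 +ℤ + 0            ≡⟨ ℤ.+-identityʳ _ ⟩
    + 1 *ℤ g 0                   ≡⟨ ℤ.*-identityˡ (g 0) ⟩
    g 0                          ∎
  agrees-below (suc n) m m≤1+n with m ≤? n
  ... | yes m≤n = agrees-below n m m≤n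
  ... | no  m≰n with ≤-antisym m≤1+n (≰⇒> m≰n)
  ... | refl = begin
    inv f (suc n)                                    ≡⟨ inv-suc f n ⟩
    -ℤ ∑[ i < suc n ] (f (suc i) *ℤ inv f (n ∸ i))   ≡⟨ cong -ℤ_ (∑-cong (suc n) IH) ⟩
    -ℤ ∑[ i < suc n ] (f (suc i) *ℤ g (n ∸ i))       ≡⟨ sym (recurrence n) ⟩
    g (suc n)                                        ∎
    where
    IH : ∀ i → i < suc n → f (suc i) *ℤ inv f (n ∸ i) ≡ f (suc i) *ℤ g (n ∸ i)
    IH i _ = cong (f (suc i) *ℤ_) (agrees-below n (n ∸ i) (m∸n≤m n i))

-- Only the exponents e j ≤ m contribute to the q^m coefficient, and j < e j puts them all below
-- j = m + 1.
module Theta (e : ℕ → ℕ) (j<e[j] : ∀ j → j < e j) where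

  θ : Series
  θ m = ∑[ j < suc m ] (sgn j *ℤ δ m (e j))

  θ≤ : ℕ → Series
  θ≤ K m = ∑[ j < K ] (sgn j *ℤ δ m (e j))

  θ-truncate : ∀ {m} n → m ≤ n → θ m ≡ θ≤ (suc n) m
  θ-truncate {m} n m≤n = sym (begin
    ∑ (suc n) h                                    ≡⟨ cong (λ l → ∑ (suc l) h) (sym (m+[n∸m]≡n m≤n)) ⟩
    ∑ (suc m + (n ∸ m)) h                          ≡⟨ ∑-split h (suc m) (n ∸ m) ⟩
    ∑ (suc m) h +ℤ ∑[ i < n ∸ m ] h (suc m + i)    ≡⟨ cong (∑ (suc m) h +ℤ_) (∑-zero (n ∸ m) vanishes) ⟩
    ∑ (suc m) h +ℤ + 0                             ≡⟨ ℤ.+-identityʳ _ ⟩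
    θ m                                            ∎)
    where
    open ≡-Reasoning
    h = λ j → sgn j *ℤ δ m (e j)
    vanishes : ∀ i → i < n ∸ m → h (suc m + i) ≡ + 0
    vanishes i _ = trans (cong (sgn (suc m + i) *ℤ_) (δ-≢ e≢m)) (ℤ.*-zeroʳ (sgn (suc m + i)))
      where
      e≢m : e (suc m + i) ≢ m
      e≢m e≡m = <-irrefl (sym e≡m) (<-trans (m≤m+n (suc m) i) (j<e[j] (suc m + i)))

  ⊛-θ≤ : ∀ f K n → (f ⊛ θ≤ K) n ≡ ∑[ j < K ] (sgn j *ℤ shift (e j) f n)
  ⊛-θ≤ f zero    n = ∑-zero (suc n) (λ i _ → ℤ.*-zeroʳ (f i))
  ⊛-θ≤ f (suc K) n = begin
    (f ⊛ θ≤ (suc K)) n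
      ≡⟨ ⊛-congʳ f n (λ m _ → ∑-last (λ j → sgn j *ℤ δ m (e j)) K) ⟩
    (f ⊛ (λ m → θ≤ K m +ℤ sgn K *ℤ δ m (e K))) n
      ≡⟨ ⊛-distribˡ-+ f (θ≤ K) (λ m → sgn K *ℤ δ m (e K)) n ⟩
    (f ⊛ θ≤ K) n +ℤ (f ⊛ (λ m → sgn K *ℤ δ m (e K))) n
      ≡⟨ cong₂ _+ℤ_ (⊛-θ≤ f K n) (⊛-scaleʳ f (λ m → δ m (e K)) (sgn K) n) ⟩
    S K +ℤ sgn K *ℤ (f ⊛ (λ m → δ m (e K))) n
      ≡⟨ cong (λ x → S K +ℤ sgn K *ℤ x) (trans (⊛-congʳ f n (λ m _ → δ-sym m (e K))) (⊛-δ (e K) f n)) ⟩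
    S K +ℤ sgn K *ℤ shift (e K) f n
      ≡⟨ sym (∑-last (λ j → sgn j *ℤ shift (e j) f n) K) ⟩
    S (suc K)
      ∎
    where
    open ≡-Reasoning
    S = λ K → ∑[ j < K ] (sgn j *ℤ shift (e j) f n)

  ⊛-θ : ∀ f n → (f ⊛ θ) n ≡ ∑[ j < suc n ] (sgn j *ℤ shift (e j) f n)
  ⊛-θ f n = trans (⊛-congʳ f n (λ m m≤n → θ-truncate n m≤n)) (⊛-θ≤ f (suc n) n)

↔Fin-unique : ∀ {X : Set} {k l} → X ↔ Fin k → X ↔ Fin l → k ≡ l
↔Fin-unique e f = ↔⇒≡ (↔-trans (↔-sym e) f)

↔Fin-⊎ : ∀ {X Y : Set} {k l} → X ↔ Fin k → Y ↔ Fin l → (X ⊎ Y) ↔ Fin (k + l)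
↔Fin-⊎ e f = ↔-trans (e ⊎-↔ f) (↔-sym +↔⊎)

empty↔Fin0 : ∀ {X : Set} → ¬ X → X ↔ Fin 0
empty↔Fin0 ¬x = mk↔ₛ′ (λ x → ⊥-elim (¬x x)) (λ ()) (λ ()) (λ x → ⊥-elim (¬x x))

singleton↔Fin1 : ∀ {X : Set} (x₀ : X) → (∀ x → x ≡ x₀) → X ↔ Fin 1
singleton↔Fin1 x₀ unique = mk↔ₛ′ (λ _ → Fin.zero) (λ _ → x₀)
  (λ { Fin.zero → refl ; (Fin.suc ()) }) (λ x → sym (unique x))

dec↔Fin : ∀ {X : Set} → Dec X → Nullary.Irrelevant X → Σ ℕ λ c → X ↔ Fin c
dec↔Fin (yes x) irr = 1 , singleton↔Fin1 x (λ y → irr y x)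
dec↔Fin (no ¬x) _   = 0 , empty↔Fin0 ¬x

Σ-≡-irrelevant : ∀ {X : Set} {P : X → Set} → Irrelevant P →
                 ∀ {x y} {p : P x} {q : P y} → x ≡ y → (x , p) ≡ (y , q)
Σ-≡-irrelevant irr {p = p} {q} refl = cong (_ ,_) (irr p q)

Σ-determined-irrelevant : ∀ {X : Set} (B : X → ℕ → Set) →
                          (∀ {x d d′} → B x d → B x d′ → d ≡ d′) →
                          (∀ d → Irrelevant (λ x → B x d)) → Irrelevant (λ x → Σ ℕ (B x))
Σ-determined-irrelevant B determined irr {x} (d , b) (d′ , b′) with determined {x} b b′
... | refl = cong (d ,_) (irr d {x} b b′)

∩-irrelevant : ∀ {X : Set} {P Q : X → Set} → Irrelevant P → Irrelevant Q → Irrelevant (P ∩ Q)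
∩-irrelevant irrP irrQ (p , q) (p′ , q′) = cong₂ _,_ (irrP p p′) (irrQ q q′)

Σ-cong-⇔ : ∀ {X : Set} {P Q : X → Set} → Irrelevant P → Irrelevant Q →
           P ⊆ Q → Q ⊆ P → Σ X P ↔ Σ X Q
Σ-cong-⇔ irrP irrQ P⊆Q Q⊆P = mk↔ₛ′ (λ (x , p) → x , P⊆Q p) (λ (x , q) → x , Q⊆P q)
  (λ (x , q) → cong (x ,_) (irrQ _ _)) (λ (x , p) → cong (x ,_) (irrP _ _))

∪-irrelevant : ∀ {X : Set} {Q R : X → Set} → Irrelevant Q → Irrelevant R →
               (∀ {x} → Q x → R x → ⊥) → Irrelevant (Q ∪ R)
∪-irrelevant irrQ irrR disjoint (inj₁ q) (inj₁ q′) = cong inj₁ (irrQ q q′)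
∪-irrelevant irrQ irrR disjoint (inj₁ q) (inj₂ r)  = ⊥-elim (disjoint q r)
∪-irrelevant irrQ irrR disjoint (inj₂ r) (inj₁ q)  = ⊥-elim (disjoint q r)
∪-irrelevant irrQ irrR disjoint (inj₂ r) (inj₂ r′) = cong inj₂ (irrR r r′)

Σ-split : ∀ {X : Set} {P Q R : X → Set} → Irrelevant P → Irrelevant Q → Irrelevant R →
          (∀ {x} → Q x → R x → ⊥) → P ⊆ Q ∪ R → Q ⊆ P → R ⊆ P →
          Σ X P ↔ (Σ X Q ⊎ Σ X R)
Σ-split {Q = Q} {R} irrP irrQ irrR disjoint P⊆Q∪R Q⊆P R⊆P = ↔-trans
  (Σ-cong-⇔ irrP (∪-irrelevant {Q = Q} {R} irrQ irrR disjoint) P⊆Q∪R (λ {x} → [ Q⊆P {x} , R⊆P {x} ]))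
  Σ-distribˡ-⊎

decidable-subset↔Fin : ∀ {X : Set} {k} → X ↔ Fin k → (Q : X → Set) → Decidable Q → Irrelevant Q →
                       Σ ℕ λ m → Σ X Q ↔ Fin m
decidable-subset↔Fin {k = k} e Q Q? irrQ =
  let m , f = on-Fin k (λ i → Q (Inverse.from e i)) (λ i → Q? (Inverse.from e i)) irrQ
  in m , ↔-trans (↔-sym (Σ-↔ (↔-sym e) ↔-refl)) f
  where
  on-Fin : ∀ k (Q : Fin k → Set) → Decidable Q → Irrelevant Q → Σ ℕ λ m → Σ (Fin k) Q ↔ Fin m
  on-Fin zero    Q Q? irrQ = 0 , empty↔Fin0 (λ ())
  on-Fin (suc k) Q Q? irrQ =
    let c , e₀ = dec↔Fin (Q? Fin.zero) irrQ
        m , e₊ = on-Fin k (λ i → Q (Fin.suc i)) (λ i → Q? (Fin.suc i)) irrQ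
    in c + m , ↔-trans split-zero (↔Fin-⊎ e₀ e₊)
    where
    split-zero : Σ (Fin (suc k)) Q ↔ (Q Fin.zero ⊎ Σ (Fin k) (λ i → Q (Fin.suc i)))
    split-zero = mk↔ₛ′
      (λ { (Fin.zero , q) → inj₁ q ; (Fin.suc i , q) → inj₂ (i , q) })
      (λ { (inj₁ q) → Fin.zero , q ; (inj₂ (i , q)) → Fin.suc i , q })
      (λ { (inj₁ q) → refl ; (inj₂ (i , q)) → refl })
      (λ { (Fin.zero , q) → refl ; (Fin.suc i , q) → refl })

Sorted : List ℕ → Set
Sorted = Linked _≥_

_≥head_ : ℕ → List ℕ → Set
b ≥head π = Connected _≥_ (just b) (head π)

≥head-irrelevant : ∀ b π → Nullary.Irrelevant (b ≥head π)
≥head-irrelevant b []      just-nothing just-nothing = refl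
≥head-irrelevant b (x ∷ π) (just p)     (just q)     = cong just (≤-irrelevant p q)

≥head-weaken : ∀ {b c} π → b ≤ c → b ≥head π → c ≥head π
≥head-weaken []      b≤c just-nothing = just-nothing
≥head-weaken (x ∷ π) b≤c (just x≤b)   = just (≤-trans x≤b b≤c)

sorted-irrelevant : Irrelevant Sorted
sorted-irrelevant = Linked.irrelevant ≤-irrelevant

∈ᵇ-here : ∀ x ys → x ∈ᵇ (x ∷ ys) ≡ true
∈ᵇ-here x ys = dec-true (x ∈? (x ∷ ys)) (here refl)

∈ᵇ-there : ∀ x y ys → x ∈ᵇ ys ≡ true → x ∈ᵇ (y ∷ ys) ≡ true
∈ᵇ-there x y ys x∈ys = trans (cong ((x ≡ᵇ y) ∨_) x∈ys) (∨-zeroʳ (x ≡ᵇ y))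

∈ᵇ-∷⁻ : ∀ {x y ys} → x ∈ᵇ (y ∷ ys) ≡ true → x ≡ y ⊎ x ∈ᵇ ys ≡ true
∈ᵇ-∷⁻ {x} {y} x∈y∷ys with x ≡ᵇ y in eq
... | true  = inj₁ (≡ᵇ⇒≡ x y (subst T (sym eq) tt))
... | false = inj₂ x∈y∷ys

∈ᵇ⇒≤sum : ∀ {x} π → x ∈ᵇ π ≡ true → x ≤ sum π
∈ᵇ⇒≤sum {x} (y ∷ π) x∈π with ∈ᵇ-∷⁻ {x} {y} {π} x∈π
... | inj₁ refl = m≤m+n y (sum π)
... | inj₂ x∈π′ = ≤-trans (∈ᵇ⇒≤sum π x∈π′) (m≤n+m (sum π) y)

∈ᵇ⇒≤head : ∀ {x b} π → b ≥head π → Sorted π → x ∈ᵇ π ≡ true → x ≤ b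
∈ᵇ⇒≤head {x} (y ∷ π) (just y≤b) π↓ x∈π with ∈ᵇ-∷⁻ {x} {y} {π} x∈π
... | inj₁ refl = y≤b
... | inj₂ x∈π′ = ∈ᵇ⇒≤head π (≥head-weaken π y≤b (head′ π↓)) (Linked.tail π↓) x∈π′

insert : ℕ → List ℕ → List ℕ
insert x []       = x ∷ []
insert x (y ∷ ys) with y ≤? x
... | yes _ = x ∷ y ∷ ys
... | no  _ = y ∷ insert x ys

delete : ℕ → List ℕ → List ℕ
delete x []       = []
delete x (y ∷ ys) with x ≟ y
... | yes _ = ys
... | no  _ = y ∷ delete x ys

insert-sum : ∀ x ys → sum (insert x ys) ≡ x + sum ys
insert-sum x []       = refl
insert-sum x (y ∷ ys) with y ≤? x
... | yes _ = refl
... | no  _ = trans (cong (λ w → y + w) (insert-sum x ys)) (ℕ+.x∙yz≈y∙xz y x (sum ys))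

insert-positive : ∀ {x} ys → x > 0 → All (_> 0) ys → All (_> 0) (insert x ys)
insert-positive []       x>0 []          = x>0 ∷ []
insert-positive {x} (y ∷ ys) x>0 (y>0 ∷ ys>0) with y ≤? x
... | yes _ = x>0 ∷ y>0 ∷ ys>0
... | no  _ = y>0 ∷ insert-positive ys x>0 ys>0

insert-≥head : ∀ {x b} ys → x ≤ b → b ≥head ys → b ≥head insert x ys
insert-≥head         []       x≤b _   = just x≤b
insert-≥head {x} (y ∷ ys) x≤b b≥y with y ≤? x
... | yes _ = just x≤b
... | no  _ = b≥y

insert-sorted : ∀ x {ys} → Sorted ys → Sorted (insert x ys)
insert-sorted x {[]}     _   = [-]
insert-sorted x {y ∷ ys} ys↓ with y ≤? x
... | yes y≤x = y≤x ∷ ys↓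
... | no  y≰x = insert-≥head ys (<⇒≤ (≰⇒> y≰x)) (head′ ys↓) ∷′ insert-sorted x (Linked.tail ys↓)

∈ᵇ-insert-self : ∀ x ys → x ∈ᵇ insert x ys ≡ true
∈ᵇ-insert-self x []       = ∈ᵇ-here x []
∈ᵇ-insert-self x (y ∷ ys) with y ≤? x
... | yes _ = ∈ᵇ-here x (y ∷ ys)
... | no  _ = ∈ᵇ-there x y (insert x ys) (∈ᵇ-insert-self x ys)

∈ᵇ-insert : ∀ {z} x ys → z ∈ᵇ ys ≡ true → z ∈ᵇ insert x ys ≡ true
∈ᵇ-insert {z} x (y ∷ ys) z∈ys with y ≤? x
... | yes _ = ∈ᵇ-there z x (y ∷ ys) z∈ys
... | no  _ with ∈ᵇ-∷⁻ {z} {y} {ys} z∈ys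
...   | inj₁ refl = ∈ᵇ-here y (insert x ys)
...   | inj₂ z∈ys′ = ∈ᵇ-there z y (insert x ys) (∈ᵇ-insert x ys z∈ys′)

insert-≥head-cons : ∀ {x} ys → x ≥head ys → insert x ys ≡ x ∷ ys
insert-≥head-cons []       _        = refl
insert-≥head-cons {x} (y ∷ ys) (just y≤x) with y ≤? x
... | yes _   = refl
... | no  y≰x = contradiction y≤x y≰x

delete-sum : ∀ {x} ys → x ∈ᵇ ys ≡ true → x + sum (delete x ys) ≡ sum ys
delete-sum {x} (y ∷ ys) x∈ys with x ≟ y | ∈ᵇ-∷⁻ {x} {y} {ys} x∈ys
... | yes refl | _         = refl
... | no  x≢y  | inj₁ x≡y  = contradiction x≡y x≢y
... | no  _    | inj₂ x∈ys′ = trans (ℕ+.x∙yz≈y∙xz x y _) (cong (λ w → y + w) (delete-sum ys x∈ys′))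

delete-positive : ∀ x {ys} → All (_> 0) ys → All (_> 0) (delete x ys)
delete-positive x []                      = []
delete-positive x {y ∷ ys} (y>0 ∷ ys>0) with x ≟ y
... | yes _ = ys>0
... | no  _ = y>0 ∷ delete-positive x ys>0

delete-≥head : ∀ {x b} ys → b ≥head ys → Sorted ys → b ≥head delete x ys
delete-≥head         []       b≥ys _   = b≥ys
delete-≥head {x} (y ∷ ys) b≥ys ys↓ with x ≟ y
... | yes _ = ≥head-weaken ys (Connected-drop b≥ys) (head′ ys↓)
  where
  Connected-drop : ∀ {b y} → Connected _≥_ (just b) (just y) → y ≤ b
  Connected-drop (just y≤b) = y≤b
... | no  _ = b≥ys

delete-sorted : ∀ x {ys} → Sorted ys → Sorted (delete x ys)
delete-sorted x {[]}     ys↓ = ys↓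
delete-sorted x {y ∷ ys} ys↓ with x ≟ y
... | yes _ = Linked.tail ys↓
... | no  _ = delete-≥head ys (head′ ys↓) (Linked.tail ys↓) ∷′ delete-sorted x (Linked.tail ys↓)

∈ᵇ-delete : ∀ {z} x ys → z ≢ x → z ∈ᵇ ys ≡ true → z ∈ᵇ delete x ys ≡ true
∈ᵇ-delete {z} x (y ∷ ys) z≢x z∈ys with x ≟ y | ∈ᵇ-∷⁻ {z} {y} {ys} z∈ys
... | yes refl | inj₁ z≡x   = contradiction z≡x z≢x
... | yes refl | inj₂ z∈ys′ = z∈ys′
... | no  _    | inj₁ refl  = ∈ᵇ-here y (delete x ys)
... | no  _    | inj₂ z∈ys′ = ∈ᵇ-there z y (delete x ys) (∈ᵇ-delete x ys z≢x z∈ys′)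

delete-insert : ∀ x ys → delete x (insert x ys) ≡ ys
delete-insert x [] with x ≟ x
... | yes _   = refl
... | no  x≢x = contradiction refl x≢x
delete-insert x (y ∷ ys) with y ≤? x
... | yes _ with x ≟ x
...   | yes _   = refl
...   | no  x≢x = contradiction refl x≢x
delete-insert x (y ∷ ys) | no y≰x with x ≟ y
...   | yes refl = contradiction ≤-refl y≰x
...   | no  _    = cong (y ∷_) (delete-insert x ys)

insert-delete : ∀ {x} ys → Sorted ys → x ∈ᵇ ys ≡ true → insert x (delete x ys) ≡ ys
insert-delete {x} (y ∷ ys) ys↓ x∈ys with x ≟ y | ∈ᵇ-∷⁻ {x} {y} {ys} x∈ys
... | yes refl | _        = insert-≥head-cons ys (head′ ys↓)
... | no  x≢y  | inj₁ x≡y = contradiction x≡y x≢y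
... | no  x≢y  | inj₂ x∈ys′ with y ≤? x
...   | yes y≤x = contradiction (≤-antisym (∈ᵇ⇒≤head ys (head′ ys↓) (Linked.tail ys↓) x∈ys′) y≤x) x≢y
...   | no  _   = cong (y ∷_) (insert-delete ys (Linked.tail ys↓) x∈ys′)

isPartitionOf-irrelevant : ∀ n → Irrelevant (IsPartitionOf n)
isPartitionOf-irrelevant n (π↓ , π>0 , Σπ) (π↓′ , π>0′ , Σπ′) =
  cong₂ _,_ (sorted-irrelevant π↓ π↓′)
            (cong₂ _,_ (All.irrelevant ≤-irrelevant π>0 π>0′) (≡-irrelevant Σπ Σπ′))

insert-partition : ∀ {x n π} → x > 0 → IsPartitionOf n π → IsPartitionOf (x + n) (insert x π)
insert-partition {x} {π = π} x>0 (π↓ , π>0 , refl) =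
  insert-sorted x π↓ , insert-positive π x>0 π>0 , insert-sum x π

delete-partition : ∀ {x n π} → x ∈ᵇ π ≡ true → IsPartitionOf n π → IsPartitionOf (n ∸ x) (delete x π)
delete-partition {x} {π = π} x∈π (π↓ , π>0 , refl) =
  delete-sorted x π↓ , delete-positive x π>0 ,
  trans (sym (m+n∸m≡n x _)) (cong (_∸ x) (delete-sum π x∈π))

part≤n : ∀ {x n π} → IsPartitionOf n π → x ∈ᵇ π ≡ true → x ≤ n
part≤n {π = π} (_ , _ , refl) = ∈ᵇ⇒≤sum π

IsBoundedPartition : ℕ → ℕ → List ℕ → Set
IsBoundedPartition N n π = IsPartitionOf n π × N ≥head π

BoundedPartition : ℕ → ℕ → Set
BoundedPartition N n = Σ (List ℕ) (IsBoundedPartition N n)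

HasLargestPart : ℕ → ℕ → List ℕ → Set
HasLargestPart c n π = IsPartitionOf n π × head π ≡ just c

isBoundedPartition-irrelevant : ∀ N n → Irrelevant (IsBoundedPartition N n)
isBoundedPartition-irrelevant N n {π} (p , b) (p′ , b′) =
  cong₂ _,_ (isPartitionOf-irrelevant n p p′) (≥head-irrelevant N π b b′)

hasLargestPart-irrelevant : ∀ c n → Irrelevant (HasLargestPart c n)
hasLargestPart-irrelevant c n (p , h) (p′ , h′) =
  cong₂ _,_ (isPartitionOf-irrelevant n p p′) (Decidable⇒UIP.≡-irrelevant (Maybe.≡-dec _≟_) h h′)

bounded-suc↔ : ∀ N n → BoundedPartition (suc N) n ↔
                        (BoundedPartition N n ⊎ Σ (List ℕ) (HasLargestPart (suc N) n))
bounded-suc↔ N n = Σ-split (isBoundedPartition-irrelevant (suc N) n) (isBoundedPartition-irrelevant N n)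
  (hasLargestPart-irrelevant (suc N) n) disjoint split weaken largest
  where
  split : IsBoundedPartition (suc N) n ⊆ IsBoundedPartition N n ∪ HasLargestPart (suc N) n
  split {[]}    (p , b)        = inj₁ (p , just-nothing)
  split {x ∷ π} (p , just x≤1+N) with x ≤? N
  ... | yes x≤N = inj₁ (p , just x≤N)
  ... | no  x≰N = inj₂ (p , cong just (≤-antisym x≤1+N (≰⇒> x≰N)))
  weaken : IsBoundedPartition N n ⊆ IsBoundedPartition (suc N) n
  weaken {π} (p , b) = p , ≥head-weaken π (n≤1+n N) b
  largest : HasLargestPart (suc N) n ⊆ IsBoundedPartition (suc N) n
  largest {x ∷ π} (p , refl) = p , just ≤-refl
  disjoint : ∀ {π} → IsBoundedPartition N n π → HasLargestPart (suc N) n π → ⊥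
  disjoint {x ∷ π} (_ , just 1+N≤N) (_ , refl) = <-irrefl refl 1+N≤N

largestPart↔bounded : ∀ c n → c > 0 → c ≤ n →
                      Σ (List ℕ) (HasLargestPart c n) ↔ BoundedPartition c (n ∸ c)
largestPart↔bounded c n c>0 c≤n = mk↔ₛ′ to from
  (λ _ → Σ-≡-irrelevant (isBoundedPartition-irrelevant c (n ∸ c)) refl)
  (λ { ((_ ∷ _) , (_ , _ ∷ _ , _) , refl) → Σ-≡-irrelevant (hasLargestPart-irrelevant c n) refl })
  where
  to : Σ (List ℕ) (HasLargestPart c n) → BoundedPartition c (n ∸ c)
  to ((c ∷ π) , (π↓ , _ ∷ π>0 , Σπ) , refl) =
    π , (Linked.tail π↓ , π>0 , trans (sym (m+n∸m≡n c (sum π))) (cong (_∸ c) Σπ)) , head′ π↓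
  from : BoundedPartition c (n ∸ c) → Σ (List ℕ) (HasLargestPart c n)
  from (π , (π↓ , π>0 , Σπ) , c≥π) =
    (c ∷ π) , (c≥π ∷′ π↓ , c>0 ∷ π>0 , trans (cong (λ m → c + m) Σπ) (m+[n∸m]≡n c≤n)) , refl

no-largestPart : ∀ {c n} → n < c → ¬ Σ (List ℕ) (HasLargestPart c n)
no-largestPart {c} n<c ((c ∷ π) , (_ , _ , refl) , refl) = <⇒≱ n<c (m≤m+n c (sum π))

bounded-zero-zero↔ : BoundedPartition 0 0 ↔ Fin 1
bounded-zero-zero↔ = singleton↔Fin1 ([] , ([] , [] , refl) , just-nothing) only-empty
  where
  only-empty : ∀ π → π ≡ ([] , ([] , [] , refl) , just-nothing)
  only-empty ([] , _) = Σ-≡-irrelevant (isBoundedPartition-irrelevant 0 0) refl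
  only-empty ((x ∷ _) , (_ , x>0 ∷ _ , _) , just x≤0) = ⊥-elim (<⇒≱ x>0 x≤0)

no-bounded-zero-suc : ∀ n → ¬ BoundedPartition 0 (suc n)
no-bounded-zero-suc n ([] , (_ , _ , ()) , _)
no-bounded-zero-suc n ((x ∷ _) , (_ , x>0 ∷ _ , _) , just x≤0) = <⇒≱ x>0 x≤0

bounded-finite : ∀ N n → Σ ℕ λ k → BoundedPartition N n ↔ Fin k
bounded-finite N n = count (suc n) N n ≤-refl
  where
  count : ∀ fuel N n → n < fuel → Σ ℕ λ k → BoundedPartition N n ↔ Fin k
  count _          zero    zero    _      = 1 , bounded-zero-zero↔
  count _          zero    (suc n) _      = 0 , empty↔Fin0 (no-bounded-zero-suc n)
  count (suc fuel) (suc N) n       n<fuel =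
    let k , e = count (suc fuel) N n n<fuel
        l , f = largest
    in k + l , ↔-trans (bounded-suc↔ N n) (↔Fin-⊎ e f)
    where
    largest : Σ ℕ λ l → Σ (List ℕ) (HasLargestPart (suc N) n) ↔ Fin l
    largest with suc N ≤? n
    ... | yes 1+N≤n =
      let l , f = count fuel (suc N) (n ∸ suc N) (<-≤-trans (∸-monoʳ-< z<s 1+N≤n) (≤-pred n<fuel))
      in l , ↔-trans (largestPart↔bounded (suc N) n z<s 1+N≤n) f
    ... | no  1+N≰n = 0 , empty↔Fin0 (no-largestPart (≰⇒> 1+N≰n))

p≤ : ℕ → ℕ → ℕ
p≤ N n = proj₁ (bounded-finite N n)

bounded↔Fin : ∀ N n → BoundedPartition N n ↔ Fin (p≤ N n)
bounded↔Fin N n = proj₂ (bounded-finite N n)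

p∞ : ℕ → ℕ
p∞ n = p≤ n n

p≤-suc : ∀ N n → p≤ (suc N) n ≡ p≤ N n + shiftWith 0 (suc N) (p≤ (suc N)) n
p≤-suc N n = ↔Fin-unique (bounded↔Fin (suc N) n)
  (↔-trans (bounded-suc↔ N n) (↔Fin-⊎ (bounded↔Fin N n) largest))
  where
  largest : Σ (List ℕ) (HasLargestPart (suc N) n) ↔ Fin (shiftWith 0 (suc N) (p≤ (suc N)) n)
  largest with suc N ≤? n
  ... | yes 1+N≤n = ↔-trans (largestPart↔bounded (suc N) n z<s 1+N≤n) (bounded↔Fin (suc N) (n ∸ suc N))
  ... | no  1+N≰n = empty↔Fin0 (no-largestPart (≰⇒> 1+N≰n))

bounded↔partition : ∀ {N n} → n ≤ N → BoundedPartition N n ↔ Partition n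
bounded↔partition {N} {n} n≤N = mk↔ₛ′ (λ (π , p , _) → π , p) (λ (π , p) → π , p , bound p)
  (λ _ → refl) (λ _ → Σ-≡-irrelevant (isBoundedPartition-irrelevant N n) refl)
  where
  bound : ∀ {π} → IsPartitionOf n π → N ≥head π
  bound {[]}    _ = just-nothing
  bound {x ∷ π} p = just (≤-trans (part≤n p (∈ᵇ-here x π)) n≤N)

partition↔Fin : ∀ n → Partition n ↔ Fin (p∞ n)
partition↔Fin n = ↔-trans (↔-sym (bounded↔partition ≤-refl)) (bounded↔Fin n n)

p≤-stable : ∀ {N n} → n ≤ N → p≤ N n ≡ p∞ n
p≤-stable {N} {n} n≤N = ↔Fin-unique (bounded↔Fin N n) (↔-trans (bounded↔partition n≤N) (partition↔Fin n))

-- Euler's product formula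

P≤ : ℕ → Series
P≤ N n = + p≤ N n

P≤-zero : P≤ 0 ≗ oneS
P≤-zero zero    = refl
P≤-zero (suc n) = refl

P≤-recurrence : ∀ N n → P≤ N n ≡ P≤ (suc N) n +ℤ -ℤ shift (suc N) (P≤ (suc N)) n
P≤-recurrence N n = begin
  + p≤ N n
    ≡⟨ sym (//-rightDividesʳ (+ s) (+ p≤ N n)) ⟩
  (+ p≤ N n +ℤ + s) +ℤ -ℤ + s
    ≡⟨ cong₂ (λ x y → x +ℤ -ℤ y) (cong +_ (sym (p≤-suc N n))) (shiftWith-map +_ (suc N) (p≤ (suc N)) n) ⟩
  P≤ (suc N) n +ℤ -ℤ shift (suc N) (P≤ (suc N)) n
    ∎
  where
  open ≡-Reasoning
  s = shiftWith 0 (suc N) (p≤ (suc N)) n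

qPoch⊛P≤ : ∀ N → qPoch N ⊛ P≤ N ≗ oneS
qPoch⊛P≤ zero    n = trans (⊛-identityˡ (P≤ 0) n) (P≤-zero n)
qPoch⊛P≤ (suc N) n = begin
  (qPoch (suc N) ⊛ P′) n                          ≡⟨ ⊛-congˡ P′ n (λ i _ → ⊛-1-q^ F k i) ⟩
  ((λ i → F i +ℤ -ℤ shift k F i) ⊛ P′) n          ≡⟨ ⊛-distribʳ-+ P′ F (λ i → -ℤ shift k F i) n ⟩
  (F ⊛ P′) n +ℤ ((λ i → -ℤ shift k F i) ⊛ P′) n   ≡⟨ cong ((F ⊛ P′) n +ℤ_) shift-left ⟩
  (F ⊛ P′) n +ℤ -ℤ shift k (F ⊛ P′) n             ≡⟨ cong ((F ⊛ P′) n +ℤ_) (sym shift-right) ⟩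
  (F ⊛ P′) n +ℤ (F ⊛ (λ m → -ℤ shift k P′ m)) n   ≡⟨ sym (⊛-distribˡ-+ F P′ (λ m → -ℤ shift k P′ m) n) ⟩
  (F ⊛ (λ m → P′ m +ℤ -ℤ shift k P′ m)) n         ≡⟨ sym (⊛-congʳ F n (λ i _ → P≤-recurrence N i)) ⟩
  (F ⊛ P≤ N) n                                     ≡⟨ qPoch⊛P≤ N n ⟩
  oneS n                                          ∎
  where
  open ≡-Reasoning
  F = qPoch N
  k = suc N
  P′ = P≤ (suc N)
  shift-left : ((λ i → -ℤ shift k F i) ⊛ P′) n ≡ -ℤ shift k (F ⊛ P′) n
  shift-left = trans (⊛-negˡ P′ (shift k F) n) (cong -ℤ_ (⊛-shiftˡ k F P′ n))
  shift-right : (F ⊛ (λ m → -ℤ shift k P′ m)) n ≡ -ℤ shift k (F ⊛ P′) n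
  shift-right = trans (⊛-negʳ F (shift k P′) n) (cong -ℤ_ (⊛-shiftʳ k F P′ n))

P∞ : Series
P∞ n = + p∞ n

inv-qPoch∞ : inv qPoch∞ ≗ P∞
inv-qPoch∞ = inv-unique qPoch∞ P∞ refl λ n → begin
  (qPoch∞ ⊛ P∞) n                ≡⟨ ⊛-congˡ P∞ n (λ i i≤n → sym (qPoch-stable i≤n)) ⟩
  (qPoch n ⊛ P∞) n               ≡⟨ ⊛-congʳ (qPoch n) n (λ i i≤n → cong +_ (sym (p≤-stable i≤n))) ⟩
  (qPoch n ⊛ P≤ n) n              ≡⟨ qPoch⊛P≤ n n ⟩
  oneS n                         ∎
  where open ≡-Reasoning

-- Partitions containing prescribed parts

ContainsAll : List ℕ → List ℕ → Set
ContainsAll xs π = All (λ x → x ∈ᵇ π ≡ true) xs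

IsPartitionContaining : List ℕ → ℕ → List ℕ → Set
IsPartitionContaining xs n π = IsPartitionOf n π × ContainsAll xs π

PartitionContaining : List ℕ → ℕ → Set
PartitionContaining xs n = Σ (List ℕ) (IsPartitionContaining xs n)

bool-≡-irrelevant : ∀ {b c : Bool} → Nullary.Irrelevant (b ≡ c)
bool-≡-irrelevant = Decidable⇒UIP.≡-irrelevant _≟𝔹_

containsAll-irrelevant : ∀ xs → Irrelevant (ContainsAll xs)
containsAll-irrelevant xs {π} = All.irrelevant (λ {y} → bool-≡-irrelevant {y ∈ᵇ π})

isPartitionContaining-irrelevant : ∀ xs n → Irrelevant (IsPartitionContaining xs n)
isPartitionContaining-irrelevant xs n {π} (p , c) (p′ , c′) =
  cong₂ _,_ (isPartitionOf-irrelevant n p p′) (containsAll-irrelevant xs {π} c c′)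

containing-∷↔ : ∀ {x xs n} → x > 0 → x ≤ n → All (x ≢_) xs →
                PartitionContaining (x ∷ xs) n ↔ PartitionContaining xs (n ∸ x)
containing-∷↔ {x} {xs} {n} x>0 x≤n x∉xs = mk↔ₛ′ to from
  (λ (ρ , _) → Σ-≡-irrelevant (isPartitionContaining-irrelevant xs (n ∸ x)) (delete-insert x ρ))
  (λ { (π , (π↓ , _) , x∈π ∷ _) →
        Σ-≡-irrelevant (isPartitionContaining-irrelevant (x ∷ xs) n) (insert-delete π π↓ x∈π) })
  where
  to : PartitionContaining (x ∷ xs) n → PartitionContaining xs (n ∸ x)
  to (π , p , x∈π ∷ xs⊆π) =
    delete x π , delete-partition x∈π p ,
    All.zipWith (λ (x≢y , y∈π) → ∈ᵇ-delete x π (λ y≡x → x≢y (sym y≡x)) y∈π) (x∉xs , xs⊆π)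
  from : PartitionContaining xs (n ∸ x) → PartitionContaining (x ∷ xs) n
  from (ρ , p , xs⊆ρ) =
    insert x ρ , subst (λ m → IsPartitionOf m (insert x ρ)) (m+[n∸m]≡n x≤n) (insert-partition x>0 p) ,
    ∈ᵇ-insert-self x ρ ∷ All.map (∈ᵇ-insert x ρ) xs⊆ρ

containing↔Fin : ∀ xs n → All (_> 0) xs → Unique xs →
                 PartitionContaining xs n ↔ Fin (shiftWith 0 (sum xs) p∞ n)
containing↔Fin [] n [] [] = ↔-trans containing-[]↔ (partition↔Fin n)
  where
  containing-[]↔ : PartitionContaining [] n ↔ Partition n
  containing-[]↔ = mk↔ₛ′ (λ (π , p , _) → π , p) (λ (π , p) → π , p , [])
    (λ _ → refl) (λ { (_ , _ , []) → refl })
containing↔Fin (x ∷ xs) n (x>0 ∷ xs>0) (x∉xs ∷ xs!) with x ≤? n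
... | yes x≤n = subst (λ k → PartitionContaining (x ∷ xs) n ↔ Fin k)
  (sym (shiftWith-+ x (sum xs) p∞ x≤n))
  (↔-trans (containing-∷↔ x>0 x≤n x∉xs) (containing↔Fin xs (n ∸ x) xs>0 xs!))
... | no  x≰n = subst (λ k → PartitionContaining (x ∷ xs) n ↔ Fin k)
  (sym (shiftWith-≰ (x + sum xs) p∞ λ x+s≤n → x≰n (≤-trans (m≤m+n x (sum xs)) x+s≤n)))
  (empty↔Fin0 λ { (π , p , x∈π ∷ _) → x≰n (part≤n p x∈π) })

-- The mex

triangular : ℕ → ℕ
triangular zero    = 0
triangular (suc j) = suc j + triangular j

triangular-double : ∀ j → triangular j * 2 ≡ j * suc j
triangular-double zero    = refl
triangular-double (suc j) = begin
  (suc j + triangular j) * 2       ≡⟨ *-distribʳ-+ 2 (suc j) (triangular j) ⟩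
  suc j * 2 + triangular j * 2     ≡⟨ cong (λ m → suc j * 2 + m) (triangular-double j) ⟩
  suc j * 2 + j * suc j            ≡⟨ lemma j ⟩
  suc j * suc (suc j)              ∎
  where
  open ≡-Reasoning
  lemma : ∀ j → suc j * 2 + j * suc j ≡ suc j * suc (suc j)
  lemma = solve-∀

progression-sum : ∀ A a j → sum (applyUpTo (λ i → a + i * A) (suc j)) ≡ expo A a j
progression-sum A a j = begin
  sum (applyUpTo u (suc j))        ≡⟨ closed-form j ⟩
  A * triangular j + a * suc j     ≡⟨ cong (_+ a * suc j) (sym half) ⟩
  expo A a j                       ∎
  where
  open ≡-Reasoning
  u = λ i → a + i * A
  half : (A * j * suc j) / 2 ≡ A * triangular j
  half = begin
    (A * j * suc j) / 2           ≡⟨ cong (_/ 2) (*-assoc A j (suc j)) ⟩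
    (A * (j * suc j)) / 2         ≡⟨ cong (λ m → (A * m) / 2) (sym (triangular-double j)) ⟩
    (A * (triangular j * 2)) / 2  ≡⟨ cong (_/ 2) (sym (*-assoc A (triangular j) 2)) ⟩
    (A * triangular j * 2) / 2    ≡⟨ m*n/n≡m (A * triangular j) 2 ⟩
    A * triangular j              ∎
  closed-form : ∀ j → sum (applyUpTo u (suc j)) ≡ A * triangular j + a * suc j
  closed-form zero    = base A a
    where
    base : ∀ A a → a + 0 * A + 0 ≡ A * 0 + a * 1
    base = solve-∀
  closed-form (suc j) = begin
    sum (applyUpTo u (suc (suc j)))                 ≡⟨ cong sum (sym (applyUpTo-∷ʳ u (suc j))) ⟩
    sum (applyUpTo u (suc j) ++ u (suc j) ∷ [])     ≡⟨ sum-++ (applyUpTo u (suc j)) _ ⟩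
    sum (applyUpTo u (suc j)) + (u (suc j) + 0)     ≡⟨ cong (_+ (u (suc j) + 0)) (closed-form j) ⟩
    A * triangular j + a * suc j + (u (suc j) + 0)  ≡⟨ step A a j (triangular j) ⟩
    A * (suc j + triangular j) + a * suc (suc j)    ∎
    where
    step : ∀ A a j t → A * t + a * suc j + ((a + suc j * A) + 0) ≡ A * (suc j + t) + a * suc (suc j)
    step = solve-∀

instance
  2*-nonZero : ∀ {n} .{{_ : NonZero n}} → NonZero (2 * n)
  2*-nonZero {n} = m*n≢0 2 n

-- Equal residues would make 2n divide their difference n.
[n+x]%2n≢x%2n : ∀ n x .{{_ : NonZero n}} → (n + x) % (2 * n) ≢ x % (2 * n)
[n+x]%2n≢x%2n n x eq = <⇒≱ n<2n (∣⇒≤ 2n∣n)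
  where
  r = x % (2 * n)
  q = x / (2 * n)
  q′ = (n + x) / (2 * n)
  n<2n : n < 2 * n
  n<2n = subst (n <_) (cong (λ m → n + m) (sym (+-identityʳ n))) (m<m+n n (>-nonZero⁻¹ n))
  n+q2n≡q′2n : n + q * (2 * n) ≡ q′ * (2 * n)
  n+q2n≡q′2n = +-cancelˡ-≡ r _ _ (begin
    r + (n + q * (2 * n))     ≡⟨ ℕ+.x∙yz≈y∙xz r n _ ⟩
    n + (r + q * (2 * n))     ≡⟨ cong (λ m → n + m) (sym (m≡m%n+[m/n]*n x (2 * n))) ⟩
    n + x                     ≡⟨ m≡m%n+[m/n]*n (n + x) (2 * n) ⟩
    (n + x) % (2 * n) + q′ * (2 * n) ≡⟨ cong (_+ q′ * (2 * n)) eq ⟩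
    r + q′ * (2 * n)          ∎)
    where open ≡-Reasoning
  2n∣n : 2 * n ∣ n
  2n∣n = ∣m+n∣m⇒∣n (subst (2 * n ∣_) (trans (sym n+q2n≡q′2n) (+-comm n _)) (n∣m*n q′)) (n∣m*n q)

module MexCount (A a : ℕ) .{{_ : NonZero A}} .{{_ : NonZero a}} where

  term : ℕ → ℕ
  term i = a + i * A

  i<term : ∀ i → i < term i
  i<term i = +-mono-≤ (>-nonZero⁻¹ a) (m≤m*n i A)

  HasTerms : ℕ → List ℕ → Set
  HasTerms k π = All (λ i → term i ∈ᵇ π ≡ true) (upTo k)

  hasTerms⁻ : ∀ {k π i} → HasTerms k π → i < k → term i ∈ᵇ π ≡ true
  hasTerms⁻ {k} {π} ts = applyUpTo⁻ {P = λ i → term i ∈ᵇ π ≡ true} (λ i → i) k ts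

  hasTerms⁺ : ∀ {k π} → (∀ {i} → i < k → term i ∈ᵇ π ≡ true) → HasTerms k π
  hasTerms⁺ {k} {π} ts = applyUpTo⁺₁ {P = λ i → term i ∈ᵇ π ≡ true} (λ i → i) k ts

  hasTerms-≤ : ∀ {k l π} → k ≤ l → HasTerms l π → HasTerms k π
  hasTerms-≤ {π = π} k≤l ts = hasTerms⁺ {π = π} (λ i<k → hasTerms⁻ {π = π} ts (<-≤-trans i<k k≤l))

  hasTerms-irrelevant : ∀ k → Irrelevant (HasTerms k)
  hasTerms-irrelevant k {π} = All.irrelevant (λ {i} → bool-≡-irrelevant {term i ∈ᵇ π})

  mexIndex-unique : ∀ {π j j′} → MexIndex A a π j → MexIndex A a π j′ → j ≡ j′
  mexIndex-unique {π} {j} {j′} (j∉π , ts) (j′∉π , ts′) with <-cmp j j′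
  ... | tri< j<j′ _ _ = contradiction (trans (sym (hasTerms⁻ {π = π} ts′ j<j′)) j∉π) λ ()
  ... | tri≈ _ j≡j′ _ = j≡j′
  ... | tri> _ _ j′<j = contradiction (trans (sym (hasTerms⁻ {π = π} ts j′<j)) j′∉π) λ ()

  mexIndex-irrelevant : ∀ j → Irrelevant (λ π → MexIndex A a π j)
  mexIndex-irrelevant j {π} (j∉π , ts) (j∉π′ , ts′) =
    cong₂ _,_ (bool-≡-irrelevant j∉π j∉π′) (hasTerms-irrelevant j {π} ts ts′)

  -- The search stops by index n: term i > i, while every part of a partition of n is at most n.
  mexIndex-≥ : ∀ {n π k} → IsPartitionOf n π → HasTerms k π → Σ ℕ λ d → MexIndex A a π (k + d)
  mexIndex-≥ {n} {π} {k} p ts = search k (suc n) ts (<-≤-trans (n<1+n n) (m≤n+m (suc n) k))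
    where
    search : ∀ k fuel → HasTerms k π → n < k + fuel → Σ ℕ λ d → MexIndex A a π (k + d)
    search k fuel ts n<k+fuel with term k ∈ᵇ π in eq
    ... | false = 0 , subst (MexIndex A a π) (sym (+-identityʳ k)) (eq , ts)
    search k zero ts n<k+0 | true =
      ⊥-elim (<⇒≱ (<-trans (subst (n <_) (+-identityʳ k) n<k+0) (i<term k)) (part≤n p eq))
    search k (suc fuel) ts n<k+1+fuel | true =
      let ts′ = subst (All _) (upTo-∷ʳ k) (∷ʳ⁺ ts eq)
          d , mex = search (suc k) fuel ts′ (subst (n <_) (+-suc k fuel) n<k+1+fuel)
      in suc d , subst (MexIndex A a π) (sym (+-suc k d)) mex

  MexFrom : ℕ → Parity → List ℕ → Set
  MexFrom k b π = Σ ℕ λ d → MexIndex A a π (k + d) × parity d ≡ b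

  mexFrom-irrelevant : ∀ k b → Irrelevant (MexFrom k b)
  mexFrom-irrelevant k b {π} = Σ-determined-irrelevant (λ π d → MexIndex A a π (k + d) × parity d ≡ b)
    (λ {π} (mex , _) (mex′ , _) → +-cancelˡ-≡ k _ _ (mexIndex-unique {π} mex mex′))
    (λ d {π} (mex , e) (mex′ , e′) →
      cong₂ _,_ (mexIndex-irrelevant (k + d) {π} mex mex′) (Decidable⇒UIP.≡-irrelevant _≟ℙ_ e e′))
    {π}

  mexFrom? : ∀ {n π} k b → IsPartitionOf n π → Dec (MexFrom k b π)
  mexFrom? {π = π} k b p with mexIndex-≥ {k = 0} p []
  ... | j , mex with k ≤? j
  ...   | no  k≰j = no λ (d , mex′ , _) → k≰j (≤-trans (m≤m+n k d) (≤-reflexive (index mex′)))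
    where
    index : ∀ {d} → MexIndex A a π (k + d) → k + d ≡ j
    index mex′ = mexIndex-unique {π} mex′ mex
  ...   | yes k≤j with parity (j ∸ k) ≟ℙ b
  ...     | yes e = yes (j ∸ k , subst (MexIndex A a π) (sym (m+[n∸m]≡n k≤j)) mex , e)
  ...     | no ¬e = no λ (d , mex′ , e) → ¬e (subst (λ d → parity d ≡ b) (offset mex′) e)
    where
    offset : ∀ {d} → MexIndex A a π (k + d) → d ≡ j ∸ k
    offset mex′ = +-cancelˡ-≡ k _ _ (trans (mexIndex-unique {π} mex′ mex) (sym (m+[n∸m]≡n k≤j)))

  PartitionMexFrom : ℕ → Parity → ℕ → List ℕ → Set
  PartitionMexFrom k b n = IsPartitionOf n ∩ MexFrom k b

  partitionMexFrom-irrelevant : ∀ k b n → Irrelevant (PartitionMexFrom k b n)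
  partitionMexFrom-irrelevant k b n {π} = ∩-irrelevant {P = IsPartitionOf n} {MexFrom k b}
    (isPartitionOf-irrelevant n) (λ {π} → mexFrom-irrelevant k b {π}) {π}

  partitionHasTerms-irrelevant : ∀ k n → Irrelevant (IsPartitionOf n ∩ HasTerms k)
  partitionHasTerms-irrelevant k n {π} = ∩-irrelevant {P = IsPartitionOf n} {HasTerms k}
    (isPartitionOf-irrelevant n) (λ {π} → hasTerms-irrelevant k {π}) {π}

  mexFrom↔Fin : ∀ k b n → Σ ℕ λ c → Σ (List ℕ) (PartitionMexFrom k b n) ↔ Fin c
  mexFrom↔Fin k b n =
    let c , e = decidable-subset↔Fin (partition↔Fin n) (λ (π , _) → MexFrom k b π)
                  (λ (_ , p) → mexFrom? k b p) (λ {(π , _)} → mexFrom-irrelevant k b {π})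
    in c , ↔-trans (↔-sym Σ-assoc) e

  oddMexCount : ℕ → ℕ → ℕ
  oddMexCount n k = proj₁ (mexFrom↔Fin k 1ℙ n)

  oddMex↔Fin : ∀ n k → Σ (List ℕ) (PartitionMexFrom k 1ℙ n) ↔ Fin (oddMexCount n k)
  oddMex↔Fin n k = proj₂ (mexFrom↔Fin k 1ℙ n)

  hasTerms↔mexFrom : ∀ k n → Σ (List ℕ) (IsPartitionOf n ∩ HasTerms k) ↔
                     (Σ (List ℕ) (PartitionMexFrom k 0ℙ n) ⊎ Σ (List ℕ) (PartitionMexFrom k 1ℙ n))
  hasTerms↔mexFrom k n = Σ-split (partitionHasTerms-irrelevant k n)
    (partitionMexFrom-irrelevant k 0ℙ n) (partitionMexFrom-irrelevant k 1ℙ n)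
    disjoint split forget forget
    where
    split : IsPartitionOf n ∩ HasTerms k ⊆ PartitionMexFrom k 0ℙ n ∪ PartitionMexFrom k 1ℙ n
    split (p , ts) with mexIndex-≥ p ts
    ... | d , mex with parity d in e
    ...   | 0ℙ = inj₁ (p , d , mex , e)
    ...   | 1ℙ = inj₂ (p , d , mex , e)
    forget : ∀ {b} → PartitionMexFrom k b n ⊆ IsPartitionOf n ∩ HasTerms k
    forget {x = π} (p , d , (_ , ts) , _) = p , hasTerms-≤ {π = π} (m≤m+n k d) ts
    disjoint : ∀ {π} → PartitionMexFrom k 0ℙ n π → PartitionMexFrom k 1ℙ n π → ⊥
    disjoint {π} (_ , d , mex , e) (_ , d′ , mex′ , e′)
      with +-cancelˡ-≡ k d d′ (mexIndex-unique {π} mex mex′)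
    ... | refl with trans (sym e) e′
    ...   | ()

  mexFrom-odd↔even : ∀ k n → Σ (List ℕ) (PartitionMexFrom k 1ℙ n) ↔
                             Σ (List ℕ) (PartitionMexFrom (suc k) 0ℙ n)
  mexFrom-odd↔even k n =
    Σ-cong-⇔ (partitionMexFrom-irrelevant k 1ℙ n) (partitionMexFrom-irrelevant (suc k) 0ℙ n)
      (λ { {π} (p , suc d , mex , e) →
             p , d , subst (MexIndex A a π) (+-suc k d) mex ,
             trans (sym (suc-homo-⁻¹ d)) (cong _⁻¹ e) })
      (λ { {π} (p , d , mex , e) →
             p , suc d , subst (MexIndex A a π) (sym (+-suc k d)) mex ,
             trans (sym (⁻¹-selfInverse (suc-homo-⁻¹ d))) (cong _⁻¹ e) })

  termsCount : ℕ → ℕ → ℕ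
  termsCount n k = shiftWith 0 (sum (applyUpTo term k)) p∞ n

  hasTerms↔Fin : ∀ k n → Σ (List ℕ) (IsPartitionOf n ∩ HasTerms k) ↔ Fin (termsCount n k)
  hasTerms↔Fin k n = ↔-trans
    (Σ-cong-⇔ (partitionHasTerms-irrelevant k n) (isPartitionContaining-irrelevant (applyUpTo term k) n)
              (λ {π} (p , ts) → p , applyUpTo⁺₁ term k (hasTerms⁻ {π = π} ts))
              (λ {π} (p , c) → p , hasTerms⁺ {π = π} (applyUpTo⁻ term k c)))
    (containing↔Fin (applyUpTo term k) n positive distinct)
    where
    positive : All (_> 0) (applyUpTo term k)
    positive = applyUpTo⁺₁ term k (λ {i} _ → <-≤-trans (>-nonZero⁻¹ a) (m≤m+n a (i * A)))
    distinct : Unique (applyUpTo term k)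
    distinct = allPairs-applyUpTo⁺₁ term k λ {i} {j} i<j _ term[i]≡term[j] →
      <-irrefl (*-cancelʳ-≡ i j A (+-cancelˡ-≡ a _ _ term[i]≡term[j])) i<j

  termsCount-suc : ∀ n k → termsCount n (suc k) ≡ oddMexCount n k + oddMexCount n (suc k)
  termsCount-suc n k = ↔Fin-unique (hasTerms↔Fin (suc k) n)
    (↔-trans (hasTerms↔mexFrom (suc k) n)
      (↔Fin-⊎ (↔-trans (↔-sym (mexFrom-odd↔even k n)) (oddMex↔Fin n k)) (oddMex↔Fin n (suc k))))

  oddMexCount-vanishes : ∀ n → oddMexCount n (suc n) ≡ 0
  oddMexCount-vanishes n = ↔Fin-unique (oddMex↔Fin n (suc n)) (empty↔Fin0 λ (π , p , d , (_ , ts) , _) →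
    <⇒≱ (i<term n) (part≤n p (hasTerms⁻ {π = π} ts (m≤m+n (suc n) d))))

  oddMexCount-alternating : ∀ n → + oddMexCount n 0 ≡ ∑[ j < suc n ] (sgn j *ℤ + termsCount n (suc j))
  oddMexCount-alternating n = alternating-sum (λ k → + oddMexCount n k) (λ k → + termsCount n (suc k))
    (λ k → cong +_ (termsCount-suc n k)) (suc n) 0 (cong +_ (oddMexCount-vanishes n))

  residue : Parity → ℕ
  residue 0ℙ = a
  residue 1ℙ = A + a

  term-residue : ∀ j → term j % (2 * A) ≡ residue (parity j) % (2 * A)
  term-residue zero          = cong (_% (2 * A)) (+-identityʳ a)
  term-residue (suc zero)    = cong (_% (2 * A)) (trans (cong (λ m → a + m) (+-identityʳ A)) (+-comm a A))
  term-residue (suc (suc j)) = trans (cong (_% (2 * A)) (two-steps a A (j * A)))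
                                     (trans ([m+n]%n≡m%n (term j) (2 * A)) (term-residue j))
    where
    two-steps : ∀ a A x → a + (A + (A + x)) ≡ (a + x) + 2 * A
    two-steps = solve-∀

  mexCond-irrelevant : Irrelevant (MexCond A a)
  mexCond-irrelevant {π} = Σ-determined-irrelevant WithResidue
    (λ {π} (mex , _) (mex′ , _) → mexIndex-unique {π} mex mex′)
    (λ j {π} (mex , e) (mex′ , e′) → cong₂ _,_ (mexIndex-irrelevant j {π} mex mex′) (≡-irrelevant e e′))
    {π}
    where
    WithResidue : List ℕ → ℕ → Set
    WithResidue π j = MexIndex A a π j × term j % (2 * A) ≡ (A + a) % (2 * A)

  mexPartition↔oddMex : ∀ n → MexPartition A a n ↔ Σ (List ℕ) (PartitionMexFrom 0 1ℙ n)
  mexPartition↔oddMex n = Σ-cong-⇔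
    (λ {π} → ∩-irrelevant {P = IsPartitionOf n} {MexCond A a} (isPartitionOf-irrelevant n)
                          (λ {π} → mexCond-irrelevant {π}) {π})
    (partitionMexFrom-irrelevant 0 1ℙ n)
    (λ (p , j , mex , j≡A+a) → p , j , mex , odd j j≡A+a)
    (λ (p , d , mex , e) → p , d , mex , trans (term-residue d) (cong (λ b → residue b % (2 * A)) e))
    where
    odd : ∀ j → term j % (2 * A) ≡ (A + a) % (2 * A) → parity j ≡ 1ℙ
    odd j j≡A+a with parity j in e
    ... | 1ℙ = refl
    ... | 0ℙ = ⊥-elim ([n+x]%2n≢x%2n A a
                 (trans (sym j≡A+a) (trans (term-residue j) (cong (λ b → residue b % (2 * A)) e))))

  mexPartition↔Fin : ∀ n → MexPartition A a n ↔ Fin (oddMexCount n 0)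
  mexPartition↔Fin n = ↔-trans (mexPartition↔oddMex n) (oddMex↔Fin n 0)

rhsSeries-expansion : ∀ A a .{{_ : NonZero a}} n →
                      rhsSeries A a n ≡ ∑[ j < suc n ] (sgn j *ℤ + shiftWith 0 (expo A a j) p∞ n)
rhsSeries-expansion A a n = begin
  (inv qPoch∞ ⊛ thetaS A a) n
    ≡⟨ ⊛-θ (inv qPoch∞) n ⟩
  ∑[ j < suc n ] (sgn j *ℤ shift (expo A a j) (inv qPoch∞) n)
    ≡⟨ ∑-cong (suc n) (λ j _ → cong (sgn j *ℤ_) (shift-P∞ j)) ⟩
  ∑[ j < suc n ] (sgn j *ℤ + shiftWith 0 (expo A a j) p∞ n)
    ∎
  where
  open ≡-Reasoning
  open Theta (expo A a) (λ j → ≤-trans (m≤n*m (suc j) a) (m≤n+m _ _))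
  shift-P∞ : ∀ j → shift (expo A a j) (inv qPoch∞) n ≡ + shiftWith 0 (expo A a j) p∞ n
  shift-P∞ j = trans (shift-cong (expo A a j) inv-qPoch∞ n) (sym (shiftWith-map +_ (expo A a j) p∞ n))

theorem4p2 : (A a : ℕ) → .{{_ : NonZero A}} → .{{_ : NonZero a}} → (n : ℕ) →
    Σ ℕ λ k → (MexPartition A a n ↔ Fin k) × (rhsSeries A a n ≡ + k)
theorem4p2 A a n = oddMexCount n 0 , mexPartition↔Fin n , (begin
  rhsSeries A a n                                            ≡⟨ rhsSeries-expansion A a n ⟩
  ∑[ j < suc n ] (sgn j *ℤ + shiftWith 0 (expo A a j) p∞ n)   ≡⟨ ∑-cong (suc n) exponent-is-sum ⟩
  ∑[ j < suc n ] (sgn j *ℤ + termsCount n (suc j))            ≡⟨ sym (oddMexCount-alternating n) ⟩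
  + oddMexCount n 0                                          ∎)
  where
  open ≡-Reasoning
  open MexCount A a
  exponent-is-sum : ∀ j → j < suc n →
                    sgn j *ℤ + shiftWith 0 (expo A a j) p∞ n ≡ sgn j *ℤ + termsCount n (suc j)
  exponent-is-sum j _ = cong (λ s → sgn j *ℤ + shiftWith 0 s p∞ n) (sym (progression-sum A a j))
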